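{- Let $(X,\mathcal{C})$ be a convex geometry with closure operator $\phi$ and let $b\in X$. For any implicational base $(X,\Sigma)$ of $(X,\mathcal{C})$ and any critical generator $A$ of $b$, there exists an implication $D\to B\in\Sigma$ such that $A\subseteq D$, $b\in B$ and $\phi(A)=\phi(D)$.
   Context: A closure system on a finite set $X$ is a family $\mathcal{C}\subseteq2^X$ containing $X$ and closed under intersection, with closure operator $\phi(A)=\bigcap\{C\in\mathcal{C}:A\subseteq C\}$; it is a convex geometry if $\emptyset\in\mathcal{C}$ and every $C\in\mathcal{C}\setminus\{X\}$ has some $y\notin C$ with $C\cup\{y\}\in\mathcal{C}$. An implicational base of $(X,\mathcal{C})$ is a set $\Sigma$ of implications $D\to B$ ($D,B\subseteq X$) such that the sets $C\subseteq X$ with $D\subseteq C\Rightarrow B\subseteq C$ for all $D\to B\in\Sigma$ are exactly the members of $\mathcal{C}$. A minimal generator of $b$ is an inclusion-minimal $A\subseteq X\setminus\{b\}$ with $b\in\phi(A)$; it is a critical generator of $b$ if $\phi(A)\setminus\{a,b\}\in\mathcal{C}$ for every $a\in A$. -}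

module Defs where

open import Data.Nat using (ℕ; zero; suc)
open import Data.Fin using (Fin)
open import Relation.Binary.PropositionalEquality using (_≡_)
open import Data.Fin.Subset using (Subset; _∪_; _∈_; _∉_; _⊆_; _∩_; _─_; ⁅_⁆; ⊤; ⊥; inside; outside)
open import Data.Fin.Subset.Properties using (_⊆?_)
open import Data.Vec using (_∷_; [])
open import Data.List using (List; _∷_; []; map; _++_; filter; foldr)
open import Data.List.Membership.Propositional using () renaming (_∈_ to _∈ₗ_)
open import Data.Product using (_×_; _,_; Σ-syntax)
open import Relation.Nullary using (Dec; ¬_)
open import Relation.Nullary.Decidable using (_×-dec_)
open import Relation.Unary using (Pred; Decidable)
open import Level using (0ℓ)

-- The ground set X is Fin n; subsets of X are Subset n.
-- A family 𝒞 ⊆ 2^X is given as a decidable predicate on Subset n.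
Family : ℕ → Set₁
Family n = Pred (Subset n) 0ℓ

allSubsets : (n : ℕ) → List (Subset n)
allSubsets zero = [] ∷ []
allSubsets (suc n) = map (inside ∷_) (allSubsets n) ++ map (outside ∷_) (allSubsets n)

IsClosureSystem : ∀ {n} → Family n → Set
IsClosureSystem {n} 𝒞 = 𝒞 ⊤ × (∀ C D → 𝒞 C → 𝒞 D → 𝒞 (C ∩ D))

φ : ∀ {n} (𝒞 : Family n) → Decidable 𝒞 → Subset n → Subset n
φ {n} 𝒞 𝒞? A = foldr _∩_ ⊤ (filter (λ C → 𝒞? C ×-dec (A ⊆? C)) (allSubsets n))

IsConvexGeometry : ∀ {n} → Family n → Set
IsConvexGeometry {n} 𝒞 =
  IsClosureSystem 𝒞 × 𝒞 ⊥ ×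
  (∀ C → 𝒞 C → ¬ (C ≡ ⊤) → Σ[ y ∈ Fin n ] (y ∉ C × 𝒞 (C ∪ ⁅ y ⁆)))

Implication : ℕ → Set
Implication n = Subset n × Subset n

Respects : ∀ {n} → List (Implication n) → Subset n → Set
Respects Σ C = ∀ D B → (D , B) ∈ₗ Σ → D ⊆ C → B ⊆ C

IsImplicationalBase : ∀ {n} → Family n → List (Implication n) → Set
IsImplicationalBase {n} 𝒞 Σ = ∀ (C : Subset n) → (Respects Σ C → 𝒞 C) × (𝒞 C → Respects Σ C)

IsMinimalGenerator : ∀ {n} (𝒞 : Family n) (𝒞? : Decidable 𝒞) → Fin n → Subset n → Set
IsMinimalGenerator {n} 𝒞 𝒞? b A =
  b ∉ A × b ∈ φ 𝒞 𝒞? A ×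
  (∀ (A' : Subset n) → A' ⊆ A → b ∉ A' → b ∈ φ 𝒞 𝒞? A' → A ⊆ A')

IsCriticalGenerator : ∀ {n} (𝒞 : Family n) (𝒞? : Decidable 𝒞) → Fin n → Subset n → Set
IsCriticalGenerator 𝒞 𝒞? b A =
  IsMinimalGenerator 𝒞 𝒞? b A ×
  (∀ a → a ∈ A → 𝒞 ((φ 𝒞 𝒞? A ─ ⁅ a ⁆) ─ ⁅ b ⁆))

-- Removing b from φ(A) leaves a non-closed set, so the base has an implication D → B with
-- D ⊆ φ(A) ∖ {b} but B ⊈ φ(A) ∖ {b}. Since φ(A) is closed, B ⊆ φ(A), hence b ∈ B. If some
-- a ∈ A were missing from D, then D ⊆ φ(A) ∖ {a, b}, which is closed by criticality, and the
-- implication would force b into it. So A ⊆ D ⊆ φ(A), whence φ(A) = φ(D).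
module Submission where

open import Defs
open import Data.Nat using (ℕ; suc)
open import Data.Fin using (Fin)
open import Data.Fin.Subset using (Subset; _∈_; _∉_; _⊆_; _─_; _-_; ⁅_⁆; ⋂; inside; outside)
open import Data.Fin.Subset.Properties
  using (_⊆?_; _∈?_; x∈p∩q⁺; x∈p∩q⁻; ∈⊤; ⊆-antisym; x∈⁅x⁆; x∈⁅y⁆⇒x≡y; x∈p∧x∉q⇒x∈p─q; p─q⊆p; p─q─r≡p─r─q)
open import Data.Vec using (_∷_; []; there)
open import Data.List using (List; _∷_; []; map; filter)
open import Data.List.Membership.Propositional using (find; lose) renaming (_∈_ to _∈ₗ_)
open import Data.List.Membership.Propositional.Properties using (∈-filter⁺; ∈-map⁺; ∈-++⁺ˡ; ∈-++⁺ʳ)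
open import Data.List.Relation.Unary.All using (All; _∷_; [])
import Data.List.Relation.Unary.All as All
open import Data.List.Relation.Unary.All.Properties using (all-filter)
open import Data.List.Relation.Unary.Any using (any?; here; there)
open import Data.Product using (_×_; _,_; Σ-syntax; ∃-syntax; proj₁; proj₂)
open import Relation.Nullary using (¬_; yes; no)
open import Relation.Nullary.Decidable using (_×-dec_; ¬?; decidable-stable)
open import Relation.Unary using (Decidable)
open import Relation.Binary.PropositionalEquality using (_≡_; refl; subst)
open import Data.Empty using (⊥-elim)

private
  variable
    n : ℕ
    x : Fin n
    p q : Subset n

x∈p─q⇒x∉q : ∀ (p q : Subset n) → x ∈ p ─ q → x ∉ q
x∈p─q⇒x∉q (_ ∷ p) (outside ∷ q) (there x∈p─q) (there x∈q) = x∈p─q⇒x∉q p q x∈p─q x∈q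
x∈p─q⇒x∉q (_ ∷ p) (inside  ∷ q) (there x∈p─q) (there x∈q) = x∈p─q⇒x∉q p q x∈p─q x∈q

p⊆q∧x∉p⇒p⊆q-x : p ⊆ q → x ∉ p → p ⊆ q - x
p⊆q∧x∉p⇒p⊆q-x {x = x} p⊆q x∉p y∈p =
  x∈p∧x∉q⇒x∈p─q (p⊆q y∈p) (λ y∈⁅x⁆ → x∉p (subst (_∈ _) (x∈⁅y⁆⇒x≡y x y∈⁅x⁆) y∈p))

∈-allSubsets : ∀ (C : Subset n) → C ∈ₗ allSubsets n
∈-allSubsets []            = here refl
∈-allSubsets (inside  ∷ C) = ∈-++⁺ˡ (∈-map⁺ (inside ∷_) (∈-allSubsets C))
∈-allSubsets {suc n} (outside ∷ C) =
  ∈-++⁺ʳ (map (inside ∷_) (allSubsets n)) (∈-map⁺ (outside ∷_) (∈-allSubsets C))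

⋂-lowerBound : ∀ {Cs : List (Subset n)} {C} → C ∈ₗ Cs → ⋂ Cs ⊆ C
⋂-lowerBound {Cs = D ∷ _} (here refl) x∈⋂ = proj₁ (x∈p∩q⁻ D _ x∈⋂)
⋂-lowerBound {Cs = D ∷ _} (there C∈Cs) x∈⋂ = ⋂-lowerBound C∈Cs (proj₂ (x∈p∩q⁻ D _ x∈⋂))

⊆-⋂ : ∀ {A : Subset n} {Cs} → All (λ C → A ⊆ C) Cs → A ⊆ ⋂ Cs
⊆-⋂ []            x∈A = ∈⊤
⊆-⋂ (A⊆C ∷ A⊆Cs) x∈A = x∈p∩q⁺ (A⊆C x∈A , ⊆-⋂ A⊆Cs x∈A)

closed-⋂ : ∀ {𝒞 : Family n} → IsClosureSystem 𝒞 → ∀ {Cs} → All 𝒞 Cs → 𝒞 (⋂ Cs)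
closed-⋂ (𝒞⊤ , _)            []       = 𝒞⊤
closed-⋂ cs@(_ , closed-∩) (𝒞C ∷ 𝒞Cs) = closed-∩ _ _ 𝒞C (closed-⋂ cs 𝒞Cs)

module Closure {n : ℕ} (𝒞 : Family n) (𝒞? : Decidable 𝒞) where

  private
    cl : Subset n → Subset n
    cl = φ 𝒞 𝒞?

    closedAbove? : (A : Subset n) → Decidable (λ C → 𝒞 C × A ⊆ C)
    closedAbove? A C = 𝒞? C ×-dec (A ⊆? C)

    closedAbove : (A : Subset n) → All (λ C → 𝒞 C × A ⊆ C) (filter (closedAbove? A) (allSubsets n))
    closedAbove A = all-filter (closedAbove? A) (allSubsets n)

  φ-least : ∀ {A C} → 𝒞 C → A ⊆ C → cl A ⊆ C
  φ-least {A} {C} 𝒞C A⊆C =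
    ⋂-lowerBound (∈-filter⁺ (closedAbove? A) (∈-allSubsets C) (𝒞C , A⊆C))

  φ-extensive : ∀ A → A ⊆ cl A
  φ-extensive A = ⊆-⋂ (All.map proj₂ (closedAbove A))

  φ-closed : IsClosureSystem 𝒞 → ∀ A → 𝒞 (cl A)
  φ-closed cs A = closed-⋂ cs (All.map proj₁ (closedAbove A))

  φ-≡ : IsClosureSystem 𝒞 → ∀ {A D} → A ⊆ D → D ⊆ cl A → cl A ≡ cl D
  φ-≡ cs {A} {D} A⊆D D⊆clA =
    ⊆-antisym (φ-least (φ-closed cs D) (λ x∈A → φ-extensive D (A⊆D x∈A)))
              (φ-least (φ-closed cs A) D⊆clA)

  φ-remove-generated-not-closed : ∀ {A b} → b ∉ A → b ∈ cl A → ¬ 𝒞 (cl A - b)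
  φ-remove-generated-not-closed {A} {b} b∉A b∈clA 𝒞clA-b =
    x∈p─q⇒x∉q (cl A) ⁅ b ⁆ (φ-least 𝒞clA-b (p⊆q∧x∉p⇒p⊆q-x (φ-extensive A) b∉A) b∈clA) (x∈⁅x⁆ b)

Violates : Subset n → Implication n → Set
Violates C (D , B) = D ⊆ C × ¬ (B ⊆ C)

violates? : (C : Subset n) → Decidable (Violates C)
violates? C (D , B) = (D ⊆? C) ×-dec ¬? (B ⊆? C)

violated-implication : ∀ {𝒞 : Family n} {Σ} → IsImplicationalBase 𝒞 Σ → ∀ {C} → ¬ 𝒞 C →
  ∃[ DB ] (DB ∈ₗ Σ × Violates C DB)
violated-implication {Σ = Σ} base {C} ¬𝒞C with any? (violates? C) Σ
... | yes violation = find violation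
... | no  noViolation = ⊥-elim (¬𝒞C (proj₁ (base C) respects))
  where
  respects : Respects Σ C
  respects D B DB∈Σ D⊆C =
    decidable-stable (B ⊆? C) (λ B⊈C → noViolation (lose DB∈Σ ((λ {x} → D⊆C {x}) , B⊈C)))

module _ {n : ℕ} (𝒞 : Family n) (𝒞? : Decidable 𝒞) where
  open Closure 𝒞 𝒞?

  critical-implication : IsClosureSystem 𝒞 → ∀ {Σ} → IsImplicationalBase 𝒞 Σ →
    ∀ {A b} → b ∉ A → b ∈ φ 𝒞 𝒞? A → (∀ a → a ∈ A → 𝒞 (φ 𝒞 𝒞? A - a - b)) →
    Σ[ D ∈ Subset n ] Σ[ B ∈ Subset n ]
      ((D , B) ∈ₗ Σ × A ⊆ D × b ∈ B × φ 𝒞 𝒞? A ≡ φ 𝒞 𝒞? D)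
  critical-implication cs base {A} {b} b∉A b∈clA critical
    with (D , B) , DB∈Σ , D⊆clA-b , B⊈clA-b
           ← violated-implication base (φ-remove-generated-not-closed b∉A b∈clA)
    = D , B , DB∈Σ , A⊆D , b∈B , φ-≡ cs A⊆D D⊆clA
    where
    clA = φ 𝒞 𝒞? A

    D⊆clA : D ⊆ clA
    D⊆clA x∈D = p─q⊆p clA ⁅ b ⁆ (D⊆clA-b x∈D)

    b∈B : b ∈ B
    b∈B = decidable-stable (b ∈? B) λ b∉B →
      B⊈clA-b (p⊆q∧x∉p⇒p⊆q-x (proj₂ (base clA) (φ-closed cs A) D B DB∈Σ D⊆clA) b∉B)

    A⊆D : A ⊆ D
    A⊆D {a} a∈A = decidable-stable (a ∈? D) λ a∉D →
      let D⊆clA-a-b = subst (D ⊆_) (p─q─r≡p─r─q clA ⁅ b ⁆ ⁅ a ⁆) (p⊆q∧x∉p⇒p⊆q-x D⊆clA-b a∉D)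
          b∈clA-a-b = proj₂ (base _) (critical a a∈A) D B DB∈Σ D⊆clA-a-b b∈B
      in x∈p─q⇒x∉q (clA - a) ⁅ b ⁆ b∈clA-a-b (x∈⁅x⁆ b)

lemma14 : ∀ {n : ℕ} (𝒞 : Family n) (𝒞? : Decidable 𝒞) → IsConvexGeometry 𝒞 →
    (b : Fin n) (Σ : List (Implication n)) → IsImplicationalBase 𝒞 Σ →
    (A : Subset n) → IsCriticalGenerator 𝒞 𝒞? b A →
    Σ[ D ∈ Subset n ] Σ[ B ∈ Subset n ]
      ((D , B) ∈ₗ Σ × A ⊆ D × b ∈ B × φ 𝒞 𝒞? A ≡ φ 𝒞 𝒞? D)
lemma14 𝒞 𝒞? (cs , _) b Σ base A ((b∉A , b∈φA , _) , critical) =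
  critical-implication 𝒞 𝒞? cs base b∉A b∈φA critical
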